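{- Let $\Gamma$ be a connected cubic graph (finite or infinite) of girth $6$ such that: (1) $\Gamma$ has a consistent $6$-cycle $C$; (2) every $3$-arc of $\Gamma$ is contained in a $6$-cycle; and (3) the subgraph $\Delta$ of $\Gamma$ induced by $V(C)$ together with all neighbours of vertices of $C$ has exactly $12$ edges. Then $\Gamma$ is isomorphic to the Pappus graph or to the Desargues graph.
   Context: A cycle $v_0v_1\cdots v_{k-1}v_0$ is consistent if some automorphism $\gamma$ of $\Gamma$ satisfies $\gamma(v_i)=v_{i+1}$ for all $i$ (indices mod $k$). A $3$-arc is a sequence of vertices $x_0x_1x_2x_3$ with $x_ix_{i+1}$ edges and $x_i\neq x_{i+2}$. The girth is the length of a shortest cycle. -}

module Defs where

open import Data.Nat using (ℕ; zero; suc; _≤_; _<_; _≡ᵇ_)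
open import Data.Nat.DivMod using (_mod_)
open import Data.Fin using (Fin; toℕ)
open import Data.Bool using (Bool; true; false; _∧_; _∨_; T)
open import Data.List using (List; []; _∷_)
open import Data.Bool.ListAction using (any)
open import Data.Product using (Σ; _×_; _,_; ∃)
open import Data.Sum using (_⊎_)
open import Data.Empty using (⊥)
open import Relation.Nullary using (¬_)
open import Relation.Binary.PropositionalEquality using (_≡_; _≢_)
open import Function.Definitions using (Injective)

record Graph : Set₁ where
  field
    V   : Set
    Adj : V → V → Set
open Graph public

Simple : Graph → Set
Simple G = (∀ u v → Adj G u v → Adj G v u) × (∀ v → ¬ Adj G v v)

Cubic : Graph → Set
Cubic G = ∀ v → Σ (V G) λ a → Σ (V G) λ b → Σ (V G) λ c →
  (a ≢ b) × (a ≢ c) × (b ≢ c) ×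
  Adj G v a × Adj G v b × Adj G v c ×
  (∀ w → Adj G v w → (w ≡ a) ⊎ (w ≡ b) ⊎ (w ≡ c))

data Walk (G : Graph) : V G → V G → Set where
  nil  : ∀ {u} → Walk G u u
  cons : ∀ {u v w} → Adj G u v → Walk G v w → Walk G u w

Connected : Graph → Set
Connected G = ∀ u v → Walk G u v

csuc : ∀ {m} → Fin (suc m) → Fin (suc m)
csuc {m} i = suc (toℕ i) mod (suc m)

IsCycle : (G : Graph) {m : ℕ} → (Fin (suc m) → V G) → Set
IsCycle G c = Injective _≡_ _≡_ c × (∀ i → Adj G (c i) (c (csuc i)))

-- girth 6: there is a 6-cycle and no cycle of length 3, 4 or 5
Girth6 : Graph → Set
Girth6 G =
  (∀ m → 2 ≤ m → m < 5 → (c : Fin (suc m) → V G) → ¬ IsCycle G c) ×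
  (Σ (Fin 6 → V G) λ c → IsCycle G c)

record Iso (G H : Graph) : Set where
  field
    to      : V G → V H
    from    : V H → V G
    from-to : ∀ x → from (to x) ≡ x
    to-from : ∀ y → to (from y) ≡ y
    adj→    : ∀ u v → Adj G u v → Adj H (to u) (to v)
    adj←    : ∀ u v → Adj H (to u) (to v) → Adj G u v
open Iso public

Aut : Graph → Set
Aut G = Iso G G

Consistent : (G : Graph) {m : ℕ} → (Fin (suc m) → V G) → Set
Consistent G c = Σ (Aut G) λ γ → ∀ i → to γ (c i) ≡ c (csuc i)

ArcsOn6Cycles : Graph → Set
ArcsOn6Cycles G = ∀ x0 x1 x2 x3 →
  Adj G x0 x1 → Adj G x1 x2 → Adj G x2 x3 → x0 ≢ x2 → x1 ≢ x3 →
  Σ (Fin 6 → V G) λ c → IsCycle G c ×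
    (c Fin.zero ≡ x0) × (c (Fin.suc Fin.zero) ≡ x1) ×
    (c (Fin.suc (Fin.suc Fin.zero)) ≡ x2) ×
    (c (Fin.suc (Fin.suc (Fin.suc Fin.zero))) ≡ x3)
  where import Data.Fin as Fin

InΔ : (G : Graph) → (Fin 6 → V G) → V G → Set
InΔ G c x = Σ (Fin 6) λ i → (x ≡ c i) ⊎ Adj G (c i) x

SameEdge : {A : Set} → A × A → A × A → Set
SameEdge (u , v) (u' , v') = (u ≡ u' × v ≡ v') ⊎ (u ≡ v' × v ≡ u')

InducedHasExactlyEdges : (G : Graph) → (V G → Set) → ℕ → Set
InducedHasExactlyEdges G S n =
  Σ (Fin n → V G × V G) λ e →
    (∀ i → let (u , v) = e i in S u × S v × Adj G u v) ×
    (∀ i j → ¬ (i ≡ j) → ¬ SameEdge (e i) (e j)) ×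
    (∀ u v → S u → S v → Adj G u v → Σ (Fin n) λ i → SameEdge (u , v) (e i))

edgeB : List (ℕ × ℕ) → ℕ → ℕ → Bool
edgeB es i j = any (λ { (a , b) → ((a ≡ᵇ i) ∧ (b ≡ᵇ j)) ∨ ((a ≡ᵇ j) ∧ (b ≡ᵇ i)) }) es

ListGraph : ℕ → List (ℕ × ℕ) → Graph
ListGraph n es = record { V = Fin n ; Adj = λ i j → T (edgeB es (toℕ i) (toℕ j)) }

-- Pappus graph: LCF [5,7,-7,7,-7,-5]^3 on 18 vertices
pappusEdges : List (ℕ × ℕ)
pappusEdges = (0 , 1) ∷ (0 , 5) ∷ (0 , 17) ∷ (1 , 2) ∷ (1 , 8) ∷ (2 , 3) ∷ (2 , 13) ∷ (3 , 4) ∷ (3 , 10) ∷ (4 , 5) ∷ (4 , 15) ∷ (5 , 6) ∷ (6 , 7) ∷ (6 , 11) ∷ (7 , 8) ∷ (7 , 14) ∷ (8 , 9) ∷ (9 , 10) ∷ (9 , 16) ∷ (10 , 11) ∷ (11 , 12) ∷ (12 , 13) ∷ (12 , 17) ∷ (13 , 14) ∷ (14 , 15) ∷ (15 , 16) ∷ (16 , 17) ∷ []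

Pappus : Graph
Pappus = ListGraph 18 pappusEdges

-- Desargues graph: LCF [5,-5,9,-9]^5 on 20 vertices (= GP(10,3))
desarguesEdges : List (ℕ × ℕ)
desarguesEdges = (0 , 1) ∷ (0 , 5) ∷ (0 , 19) ∷ (1 , 2) ∷ (1 , 16) ∷ (2 , 3) ∷ (2 , 11) ∷ (3 , 4) ∷ (3 , 14) ∷ (4 , 5) ∷ (4 , 9) ∷ (5 , 6) ∷ (6 , 7) ∷ (6 , 15) ∷ (7 , 8) ∷ (7 , 18) ∷ (8 , 9) ∷ (8 , 13) ∷ (9 , 10) ∷ (10 , 11) ∷ (10 , 19) ∷ (11 , 12) ∷ (12 , 13) ∷ (12 , 17) ∷ (13 , 14) ∷ (14 , 15) ∷ (15 , 16) ∷ (16 , 17) ∷ (17 , 18) ∷ (18 , 19) ∷ []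

Desargues : Graph
Desargues = ListGraph 20 desarguesEdges

{-# OPTIONS --safe #-}
module Submission where

-- Write C = C₀ … C₅ and let γ be the automorphism rotating it. Girth 6 makes the cycle
-- and its six spokes Cᵢdᵢ twelve distinct edges of Δ, so Δ has no others; in particular
-- no two dᵢ are adjacent. The 6-cycle through the 3-arc Cᵢ₋₁CᵢCᵢ₊₁dᵢ₊₁ can then only close
-- through a common neighbour eᵢ of dᵢ₋₁ and dᵢ₊₁, and γ maps dᵢ ↦ dᵢ₊₁, eᵢ ↦ eᵢ₊₁.
-- If e₀ = e₂ the eᵢ collapse to two vertices, each adjacent to three of the dᵢ, and the 6-cycle
-- through d₀C₀C₁d₁ forces the third neighbours fᵢ of the dᵢ to form a hexagon: Desargues.
-- Otherwise the same 6-cycle forces eᵢ ~ eᵢ₊₃: Pappus. Either way the named vertices give a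
-- locally bijective map from the model graph to the connected cubic Γ; as any two model
-- vertices are joined by a non-backtracking walk of length at most 5, girth 6 makes this
-- map injective, hence an isomorphism.

open import Defs
open import Data.Empty using (⊥; ⊥-elim)
open import Data.Fin using (Fin; toℕ; _≟_; #_; _↑ˡ_)
open import Data.Fin.Patterns using (0F; 1F; 2F; 3F; 4F; 5F)
import Data.Fin.Properties as Fin
open import Data.List using (List; []; _∷_; length; map; concatMap; filter)
open import Data.List.Properties using (length-map)
open import Data.List.Relation.Unary.Any using (Any; any?; satisfied)
open import Data.Nat using (ℕ; zero; suc; _≤_; s≤s; z≤n; _≤?_)
open import Data.Nat.Properties using (n<1+n)
open import Data.Product using (∃; ∃₂; _×_; _,_; proj₁; proj₂)
open import Data.Sum using (_⊎_; inj₁; inj₂; [_,_])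
import Data.Sum.Properties
open import Function using (_∘_; case_of_)
open import Data.Unit using (⊤; tt)
open import Data.Vec using (Vec; []; _∷_; lookup)
open import Data.Vec.Relation.Unary.All using ([]; _∷_)
open import Data.Vec.Relation.Unary.AllPairs using ([]; _∷_)
open import Data.Vec.Relation.Unary.Unique.Propositional using (Unique)
open import Data.Vec.Relation.Unary.Unique.Propositional.Properties using (lookup-injective)
open import Relation.Binary using (Decidable; DecidableEquality)
open import Relation.Nullary using (¬_; Dec; yes; no; ¬?; _×-dec_; _⊎-dec_; _→-dec_; T?)
open import Relation.Nullary.Decidable using (from-yes)
open import Relation.Binary.PropositionalEquality
  using (_≡_; _≢_; refl; sym; trans; cong; subst; subst₂; ≢-sym)

NonBacktracking : {A : Set} → (A → A → Set) → List A → Set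
NonBacktracking R (x ∷ y ∷ z ∷ w) = R x y × x ≢ z × NonBacktracking R (y ∷ z ∷ w)
NonBacktracking R (x ∷ y ∷ [])    = R x y
NonBacktracking R _               = ⊤

nonBacktracking? : {A : Set} {R : A → A → Set} →
  Decidable R → DecidableEquality A → (w : List A) → Dec (NonBacktracking R w)
nonBacktracking? R? _≟ᴬ_ (x ∷ y ∷ z ∷ w) =
  R? x y ×-dec ¬? (x ≟ᴬ z) ×-dec nonBacktracking? R? _≟ᴬ_ (y ∷ z ∷ w)
nonBacktracking? R? _≟ᴬ_ (x ∷ y ∷ [])    = R? x y
nonBacktracking? R? _≟ᴬ_ (x ∷ [])        = yes tt
nonBacktracking? R? _≟ᴬ_ []              = yes tt

endpoint : {A : Set} → A → List A → A
endpoint x []      = x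
endpoint x (y ∷ w) = endpoint y w

sameEdge-trans : {A : Set} {p q : A × A} (r : A × A) → SameEdge p r → SameEdge q r → SameEdge p q
sameEdge-trans _ (inj₁ (refl , refl)) (inj₁ (refl , refl)) = inj₁ (refl , refl)
sameEdge-trans _ (inj₁ (refl , refl)) (inj₂ (refl , refl)) = inj₂ (refl , refl)
sameEdge-trans _ (inj₂ (refl , refl)) (inj₁ (refl , refl)) = inj₂ (refl , refl)
sameEdge-trans _ (inj₂ (refl , refl)) (inj₂ (refl , refl)) = inj₁ (refl , refl)

noMoreEdges : ∀ {G S n} → InducedHasExactlyEdges G S n → (f : Fin (suc n) → V G × V G) →
  (∀ k → S (proj₁ (f k)) × S (proj₂ (f k)) × Adj G (proj₁ (f k)) (proj₂ (f k))) →
  (∀ k l → SameEdge (f k) (f l) → k ≡ l) → ⊥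
noMoreEdges {n = n} (e , _ , _ , covered) f edge distinct = clash (Fin.pigeonhole (n<1+n n) position)
  where
  cover : ∀ k → ∃ λ r → SameEdge (f k) (e r)
  cover k = covered _ _ (proj₁ (edge k)) (proj₁ (proj₂ (edge k))) (proj₂ (proj₂ (edge k)))

  position : Fin (suc n) → Fin n
  position k = proj₁ (cover k)

  clash : (∃₂ λ k l → k Data.Fin.< l × position k ≡ position l) → ⊥
  clash (k , l , k<l , same) =
    Fin.<⇒≢ k<l (distinct k l (sameEdge-trans (e (position k)) (proj₂ (cover k))
                                 (subst (SameEdge (f l) ∘ e) (sym same) (proj₂ (cover l)))))

record CubicModel : Set₁ where
  field
    order : ℕ
    edges : List (ℕ × ℕ)
    Label : Set
    label : Fin order → Label
    index : Label → Fin order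
    label∘index : ∀ l → label (index l) ≡ l
    nbr₁ nbr₂ nbr₃ : Label → Label

  graph : Graph
  graph = ListGraph order edges

  infix 4 _~ᴹ_
  _~ᴹ_ : Fin order → Fin order → Set
  _~ᴹ_ = Adj graph

  _~ᴹ?_ : Decidable _~ᴹ_
  a ~ᴹ? b = T? _

  n₁ n₂ n₃ : Fin order → Fin order
  n₁ = index ∘ nbr₁ ∘ label
  n₂ = index ∘ nbr₂ ∘ label
  n₃ = index ∘ nbr₃ ∘ label

  -- Candidate certificates for ShortWalk; valid? checks each one, so walks needs no proof.
  walks : ℕ → Fin order → Fin order → List (List (Fin order))
  walks zero    _    _ = [] ∷ []
  walks (suc k) prev a = [] ∷ concatMap (λ b → map (b ∷_) (walks k a b))
                                         (filter (λ b → ¬? (b ≟ prev)) (n₁ a ∷ n₂ a ∷ n₃ a ∷ []))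

  ShortWalk : Fin order → Fin order → List (Fin order) → Set
  ShortWalk a b w = endpoint a w ≡ b × NonBacktracking _~ᴹ_ (a ∷ w) × length w ≤ 5

  Valid : Set
  Valid = (∀ a → a ~ᴹ n₁ a × a ~ᴹ n₂ a × a ~ᴹ n₃ a)
        × (∀ a b → a ~ᴹ b → b ~ᴹ a × (b ≡ n₁ a ⊎ b ≡ n₂ a ⊎ b ≡ n₃ a))
        × (∀ a b → Any (ShortWalk a b) (walks 5 a a))

  valid? : Dec Valid
  valid? =
    Fin.all? (λ a → a ~ᴹ? n₁ a ×-dec a ~ᴹ? n₂ a ×-dec a ~ᴹ? n₃ a)
    ×-dec Fin.all? (λ a → Fin.all? λ b →
            a ~ᴹ? b →-dec b ~ᴹ? a ×-dec (b ≟ n₁ a ⊎-dec b ≟ n₂ a ⊎-dec b ≟ n₃ a))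
    ×-dec Fin.all? (λ a → Fin.all? λ b → any? (λ w →
            endpoint a w ≟ b ×-dec nonBacktracking? _~ᴹ?_ _≟_ (a ∷ w) ×-dec length w ≤? 5)
            (walks 5 a a))

module CubicGirth6 {Γ : Graph} (simple : Simple Γ) (cubic : Cubic Γ) (girth : Girth6 Γ) where

  infix 4 _~_
  _~_ : V Γ → V Γ → Set
  _~_ = Adj Γ

  ~-sym : ∀ {u v} → u ~ v → v ~ u
  ~-sym = proj₁ simple _ _

  ~-irrefl : ∀ {u v} → u ~ v → u ≢ v
  ~-irrefl {u} u~v refl = proj₂ simple u u~v

  noShortCycle : ∀ {m} → 2 ≤ m → m ≤ 4 → (xs : Vec (V Γ) (suc m)) → Unique xs →
    (∀ i → lookup xs i ~ lookup xs (csuc i)) → ⊥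
  noShortCycle 2≤m m≤4 xs unique adj =
    proj₁ girth _ 2≤m (s≤s m≤4) (lookup xs) (lookup-injective unique _ _ , adj)

  noTriangle : ∀ {x y z} → x ~ y → y ~ z → z ~ x → ⊥
  noTriangle {x} {y} {z} xy yz zx =
    noShortCycle (s≤s (s≤s z≤n)) (s≤s (s≤s z≤n)) (x ∷ y ∷ z ∷ [])
      ((~-irrefl xy ∷ ≢-sym (~-irrefl zx) ∷ []) ∷ (~-irrefl yz ∷ []) ∷ [] ∷ [])
      λ { 0F → xy ; 1F → yz ; 2F → zx }

  noQuadrangle : ∀ {a b c d} → a ~ b → b ~ c → c ~ d → d ~ a → a ≢ c → b ≢ d → ⊥
  noQuadrangle {a} {b} {c} {d} ab bc cd da a≢c b≢d =
    noShortCycle (s≤s (s≤s z≤n)) (s≤s (s≤s (s≤s z≤n))) (a ∷ b ∷ c ∷ d ∷ [])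
      ((~-irrefl ab ∷ a≢c ∷ ≢-sym (~-irrefl da) ∷ []) ∷ (~-irrefl bc ∷ b≢d ∷ []) ∷
       (~-irrefl cd ∷ []) ∷ [] ∷ [])
      λ { 0F → ab ; 1F → bc ; 2F → cd ; 3F → da }

  noPentagon : ∀ {a b c d e} → a ~ b → b ~ c → c ~ d → d ~ e → e ~ a →
    a ≢ c → a ≢ d → b ≢ d → b ≢ e → c ≢ e → ⊥
  noPentagon {a} {b} {c} {d} {e} ab bc cd de ea a≢c a≢d b≢d b≢e c≢e =
    noShortCycle (s≤s (s≤s z≤n)) (s≤s (s≤s (s≤s (s≤s z≤n)))) (a ∷ b ∷ c ∷ d ∷ e ∷ [])
      ((~-irrefl ab ∷ a≢c ∷ a≢d ∷ ≢-sym (~-irrefl ea) ∷ []) ∷ (~-irrefl bc ∷ b≢d ∷ b≢e ∷ []) ∷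
       (~-irrefl cd ∷ c≢e ∷ []) ∷ (~-irrefl de ∷ []) ∷ [] ∷ [])
      λ { 0F → ab ; 1F → bc ; 2F → cd ; 3F → de ; 4F → ea }

  closedNonBacktracking⇒trivial : ∀ {x} w → NonBacktracking _~_ (x ∷ w) → length w ≤ 5 →
    endpoint x w ≡ x → w ≡ []
  closedNonBacktracking⇒trivial [] _ _ _ = refl
  closedNonBacktracking⇒trivial (y ∷ []) xy _ refl = ⊥-elim (~-irrefl xy refl)
  closedNonBacktracking⇒trivial (y ∷ z ∷ []) (_ , x≢z , _) _ refl = ⊥-elim (x≢z refl)
  closedNonBacktracking⇒trivial (y ∷ z ∷ u ∷ []) (xy , _ , yz , _ , zx) _ refl =
    ⊥-elim (noTriangle xy yz zx)
  closedNonBacktracking⇒trivial (y ∷ z ∷ u ∷ v ∷ []) (xy , x≢z , yz , y≢u , zu , _ , ux) _ refl =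
    ⊥-elim (noQuadrangle xy yz zu ux x≢z y≢u)
  closedNonBacktracking⇒trivial (y ∷ z ∷ u ∷ v ∷ t ∷ [])
    (xy , x≢z , yz , y≢u , zu , z≢v , uv , u≢x , vx) _ refl =
    ⊥-elim (noPentagon xy yz zu uv vx x≢z (≢-sym u≢x) y≢u
              (λ { refl → noTriangle yz zu uv }) z≢v)
  closedNonBacktracking⇒trivial (_ ∷ _ ∷ _ ∷ _ ∷ _ ∷ _ ∷ _) _ (s≤s (s≤s (s≤s (s≤s (s≤s ()))))) _

  record Neighbourhood (v x y z : V Γ) : Set where
    field
      x≢y : x ≢ y
      x≢z : x ≢ z
      y≢z : y ≢ z
      ~x  : v ~ x
      ~y  : v ~ y
      ~z  : v ~ z
      exhaustive : ∀ {w} → v ~ w → w ≡ x ⊎ w ≡ y ⊎ w ≡ z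

  neighbourhoodOf : ∀ v → ∃ λ x → ∃₂ λ y z → Neighbourhood v x y z
  neighbourhoodOf v with cubic v
  ... | x , y , z , x≢y , x≢z , y≢z , ~x , ~y , ~z , exhaustive =
    x , y , z , record { x≢y = x≢y ; x≢z = x≢z ; y≢z = y≢z ; ~x = ~x ; ~y = ~y ; ~z = ~z
                       ; exhaustive = exhaustive _ }

  swap₁₂ : ∀ {v x y z} → Neighbourhood v x y z → Neighbourhood v y x z
  swap₁₂ N = record
    { x≢y = ≢-sym x≢y ; x≢z = y≢z ; y≢z = x≢z ; ~x = ~y ; ~y = ~x ; ~z = ~z
    ; exhaustive = λ vw → [ inj₂ ∘ inj₁ , [ inj₁ , inj₂ ∘ inj₂ ] ] (exhaustive vw) }
    where open Neighbourhood N

  swap₂₃ : ∀ {v x y z} → Neighbourhood v x y z → Neighbourhood v x z y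
  swap₂₃ N = record
    { x≢y = x≢z ; x≢z = x≢y ; y≢z = ≢-sym y≢z ; ~x = ~x ; ~y = ~z ; ~z = ~y
    ; exhaustive = λ vw → [ inj₁ , [ inj₂ ∘ inj₂ , inj₂ ∘ inj₁ ] ] (exhaustive vw) }
    where open Neighbourhood N

  focus : ∀ {v x y z p} → Neighbourhood v x y z → v ~ p → ∃₂ λ q r → Neighbourhood v p q r
  focus N vp with Neighbourhood.exhaustive N vp
  ... | inj₁ refl        = _ , _ , N
  ... | inj₂ (inj₁ refl) = _ , _ , swap₁₂ N
  ... | inj₂ (inj₂ refl) = _ , _ , swap₁₂ (swap₂₃ N)

  thirdNeighbour : ∀ {v p q} → v ~ p → v ~ q → p ≢ q → ∃ λ r → Neighbourhood v p q r
  thirdNeighbour {v} vp vq p≢q with neighbourhoodOf v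
  ... | _ , _ , _ , N with focus N vp
  ... | _ , _ , N′ with Neighbourhood.exhaustive N′ vq
  ... | inj₁ refl        = ⊥-elim (p≢q refl)
  ... | inj₂ (inj₁ refl) = _ , N′
  ... | inj₂ (inj₂ refl) = _ , swap₂₃ N′

  neighbourhood : ∀ {v p q r} → v ~ p → v ~ q → v ~ r → p ≢ q → p ≢ r → q ≢ r →
    Neighbourhood v p q r
  neighbourhood vp vq vr p≢q p≢r q≢r with thirdNeighbour vp vq p≢q
  ... | _ , N with Neighbourhood.exhaustive N vr
  ... | inj₁ refl        = ⊥-elim (p≢r refl)
  ... | inj₂ (inj₁ refl) = ⊥-elim (q≢r refl)
  ... | inj₂ (inj₂ refl) = N

  neighbour-≟ : ∀ {v p q} → v ~ p → v ~ q → Dec (p ≡ q)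
  neighbour-≟ {v} vp vq with neighbourhoodOf v
  ... | _ , _ , _ , N with focus N vp
  ... | _ , _ , N′ with Neighbourhood.exhaustive N′ vq
  ... | inj₁ refl        = yes refl
  ... | inj₂ (inj₁ refl) = no (Neighbourhood.x≢y N′)
  ... | inj₂ (inj₂ refl) = no (Neighbourhood.x≢z N′)

  atMostOneCommonNeighbour : ∀ {u v x y} → u ~ x → x ~ v → u ~ y → y ~ v → u ≢ v → x ≢ y → ⊥
  atMostOneCommonNeighbour ux xv uy yv = noQuadrangle ux xv (~-sym yv) (~-sym uy)

  record HexagonClosure (x₀ x₁ x₂ x₃ : V Γ) : Set where
    field
      {x₄ x₅} : V Γ
      x₃~x₄ : x₃ ~ x₄
      x₄~x₅ : x₄ ~ x₅
      x₅~x₀ : x₅ ~ x₀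
      x₄≢x₀ : x₄ ≢ x₀
      x₄≢x₂ : x₄ ≢ x₂
      x₅≢x₁ : x₅ ≢ x₁

  closeHexagon : ArcsOn6Cycles Γ → ∀ {x₀ x₁ x₂ x₃} → x₀ ~ x₁ → x₁ ~ x₂ → x₂ ~ x₃ →
    x₀ ≢ x₂ → x₁ ≢ x₃ → HexagonClosure x₀ x₁ x₂ x₃
  closeHexagon arcs x₀x₁ x₁x₂ x₂x₃ x₀≢x₂ x₁≢x₃
    with arcs _ _ _ _ x₀x₁ x₁x₂ x₂x₃ x₀≢x₂ x₁≢x₃
  ... | c , (injective , adjacent) , refl , refl , refl , refl = record
    { x₃~x₄ = adjacent 3F
    ; x₄~x₅ = adjacent 4F
    ; x₅~x₀ = adjacent 5F
    ; x₄≢x₀ = λ q → case injective q of λ ()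
    ; x₄≢x₂ = λ q → case injective q of λ ()
    ; x₅≢x₁ = λ q → case injective q of λ ()
    }

  LocallyBijective : (M : CubicModel) → (CubicModel.Label M → V Γ) → Set
  LocallyBijective M φ = ∀ l → Neighbourhood (φ l) (φ (nbr₁ l)) (φ (nbr₂ l)) (φ (nbr₃ l))
    where open CubicModel M

  module Covering (connected : Connected Γ) (M : CubicModel) (valid : CubicModel.Valid M)
    (φ : CubicModel.Label M → V Γ) (local : LocallyBijective M φ) where

    open CubicModel M

    ψ : Fin order → V Γ
    ψ = φ ∘ label

    ψ-neighbourhood : ∀ a → Neighbourhood (ψ a) (ψ (n₁ a)) (ψ (n₂ a)) (ψ (n₃ a))
    ψ-neighbourhood a
      rewrite label∘index (nbr₁ (label a)) | label∘index (nbr₂ (label a))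
            | label∘index (nbr₃ (label a)) = local (label a)

    n-adjacent : ∀ a → a ~ᴹ n₁ a × a ~ᴹ n₂ a × a ~ᴹ n₃ a
    n-adjacent = proj₁ valid

    ~ᴹ-sym : ∀ {a b} → a ~ᴹ b → b ~ᴹ a
    ~ᴹ-sym ab = proj₁ (proj₁ (proj₂ valid) _ _ ab)

    ~ᴹ-exhaustive : ∀ {a b} → a ~ᴹ b → b ≡ n₁ a ⊎ b ≡ n₂ a ⊎ b ≡ n₃ a
    ~ᴹ-exhaustive ab = proj₂ (proj₁ (proj₂ valid) _ _ ab)

    ~ᴹ⇒~ : ∀ {a b} → a ~ᴹ b → ψ a ~ ψ b
    ~ᴹ⇒~ {a} ab with ~ᴹ-exhaustive ab
    ... | inj₁ refl        = Neighbourhood.~x (ψ-neighbourhood a)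
    ... | inj₂ (inj₁ refl) = Neighbourhood.~y (ψ-neighbourhood a)
    ... | inj₂ (inj₂ refl) = Neighbourhood.~z (ψ-neighbourhood a)

    ψ-locallyInjective : ∀ {a b c} → a ~ᴹ b → b ~ᴹ c → a ≢ c → ψ a ≢ ψ c
    ψ-locallyInjective {b = b} ab bc a≢c with ~ᴹ-exhaustive (~ᴹ-sym ab) | ~ᴹ-exhaustive bc
    ... | inj₁ refl        | inj₁ refl        = ⊥-elim (a≢c refl)
    ... | inj₂ (inj₁ refl) | inj₂ (inj₁ refl) = ⊥-elim (a≢c refl)
    ... | inj₂ (inj₂ refl) | inj₂ (inj₂ refl) = ⊥-elim (a≢c refl)
    ... | inj₁ refl        | inj₂ (inj₁ refl) = Neighbourhood.x≢y (ψ-neighbourhood b)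
    ... | inj₁ refl        | inj₂ (inj₂ refl) = Neighbourhood.x≢z (ψ-neighbourhood b)
    ... | inj₂ (inj₁ refl) | inj₂ (inj₂ refl) = Neighbourhood.y≢z (ψ-neighbourhood b)
    ... | inj₂ (inj₁ refl) | inj₁ refl        = ≢-sym (Neighbourhood.x≢y (ψ-neighbourhood b))
    ... | inj₂ (inj₂ refl) | inj₁ refl        = ≢-sym (Neighbourhood.x≢z (ψ-neighbourhood b))
    ... | inj₂ (inj₂ refl) | inj₂ (inj₁ refl) = ≢-sym (Neighbourhood.y≢z (ψ-neighbourhood b))

    firstStep : ∀ {a b w} → NonBacktracking _~ᴹ_ (a ∷ b ∷ w) → a ~ᴹ b
    firstStep {w = []}    ab         = ab
    firstStep {w = _ ∷ _} (ab , _ , _) = ab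

    ψ-nonBacktracking : ∀ w → NonBacktracking _~ᴹ_ w → NonBacktracking _~_ (map ψ w)
    ψ-nonBacktracking (a ∷ b ∷ c ∷ w) (ab , a≢c , rest) =
      ~ᴹ⇒~ ab , ψ-locallyInjective ab (firstStep {w = w} rest) a≢c , ψ-nonBacktracking (b ∷ c ∷ w) rest
    ψ-nonBacktracking (a ∷ b ∷ []) ab = ~ᴹ⇒~ ab
    ψ-nonBacktracking (a ∷ [])     _  = tt
    ψ-nonBacktracking []           _  = tt

    ψ-endpoint : ∀ a w → endpoint (ψ a) (map ψ w) ≡ ψ (endpoint a w)
    ψ-endpoint a []      = refl
    ψ-endpoint a (b ∷ w) = ψ-endpoint b w

    shortWalk : ∀ a b → ∃ (ShortWalk a b)
    shortWalk a b = satisfied (proj₂ (proj₂ valid) a b)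

    ψ-injective : ∀ {a b} → ψ a ≡ ψ b → a ≡ b
    ψ-injective {a} {b} ψa≡ψb with shortWalk a b
    ... | w , refl , nonBacktracking , length≤5 =
      trivial w (closedNonBacktracking⇒trivial (map ψ w) (ψ-nonBacktracking (a ∷ w) nonBacktracking)
                   (subst (_≤ 5) (sym (length-map ψ w)) length≤5)
                   (trans (ψ-endpoint a w) (sym ψa≡ψb)))
      where
      trivial : ∀ w → map ψ w ≡ [] → a ≡ endpoint a w
      trivial [] _ = refl

    lift : ∀ a {x} → ψ a ~ x → ∃ λ b → a ~ᴹ b × ψ b ≡ x
    lift a ax with Neighbourhood.exhaustive (ψ-neighbourhood a) ax
    ... | inj₁ refl        = n₁ a , proj₁ (n-adjacent a) , refl
    ... | inj₂ (inj₁ refl) = n₂ a , proj₁ (proj₂ (n-adjacent a)) , refl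
    ... | inj₂ (inj₂ refl) = n₃ a , proj₂ (proj₂ (n-adjacent a)) , refl

    ~⇒~ᴹ : ∀ {a b} → ψ a ~ ψ b → a ~ᴹ b
    ~⇒~ᴹ {a} ab with lift a ab
    ... | b , a~ᴹb , ψb≡ψb′ with ψ-injective ψb≡ψb′
    ... | refl = a~ᴹb

    reach : ∀ {x y} → Walk Γ x y → ∀ a → ψ a ≡ x → ∃ λ b → ψ b ≡ y
    reach nil          a ψa≡x = a , ψa≡x
    reach (cons xz zy) a refl with lift a xz
    ... | b , _ , ψb≡z = reach zy b ψb≡z

    iso : Fin order → Iso Γ graph
    iso a₀ = record
      { to      = λ x → proj₁ (preimage x)
      ; from    = ψ
      ; from-to = λ x → proj₂ (preimage x)
      ; to-from = λ a → ψ-injective (proj₂ (preimage (ψ a)))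
      ; adj→    = λ u v uv → ~⇒~ᴹ (subst₂ _~_ (sym (proj₂ (preimage u))) (sym (proj₂ (preimage v))) uv)
      ; adj←    = λ u v uv → subst₂ _~_ (proj₂ (preimage u)) (proj₂ (preimage v)) (~ᴹ⇒~ uv)
      }
      where
      preimage : ∀ x → ∃ λ a → ψ a ≡ x
      preimage x = reach (connected (ψ a₀) x) a₀ refl

infixl 10 _⁺ _⁻ _⁺^_

_⁺ : Fin 6 → Fin 6
i ⁺ = csuc i

_⁻ : Fin 6 → Fin 6
0F ⁻ = 5F
1F ⁻ = 0F
2F ⁻ = 1F
3F ⁻ = 2F
4F ⁻ = 3F
5F ⁻ = 4F

⁺⁻ : ∀ i → i ⁺ ⁻ ≡ i
⁺⁻ = from-yes (Fin.all? λ i → i ⁺ ⁻ ≟ i)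

⁻⁺ : ∀ i → i ⁻ ⁺ ≡ i
⁻⁺ = from-yes (Fin.all? λ i → i ⁻ ⁺ ≟ i)

⁻≢⁺ : ∀ i → i ⁻ ≢ i ⁺
⁻≢⁺ = from-yes (Fin.all? λ i → ¬? (i ⁻ ≟ i ⁺))

≢⁺⁺ : ∀ i → i ≢ i ⁺ ⁺
≢⁺⁺ = from-yes (Fin.all? λ i → ¬? (i ≟ i ⁺ ⁺))

≢⁺⁺⁺ : ∀ i → i ≢ i ⁺ ⁺ ⁺
≢⁺⁺⁺ = from-yes (Fin.all? λ i → ¬? (i ≟ i ⁺ ⁺ ⁺))

⁻⁻⁻≢⁺ : ∀ i → i ⁻ ⁻ ⁻ ≢ i ⁺
⁻⁻⁻≢⁺ = from-yes (Fin.all? λ i → ¬? (i ⁻ ⁻ ⁻ ≟ i ⁺))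

⁻≢⁺⁺⁺ : ∀ i → i ⁻ ≢ i ⁺ ⁺ ⁺
⁻≢⁺⁺⁺ = from-yes (Fin.all? λ i → ¬? (i ⁻ ≟ i ⁺ ⁺ ⁺))

offsetWithin3 : ∀ i j → j ≡ i ⊎ j ≡ i ⁺ ⊎ j ≡ i ⁺ ⁺ ⊎ j ≡ i ⁺ ⁺ ⁺ ⊎ i ≡ j ⁺ ⁺ ⊎ i ≡ j ⁺
offsetWithin3 = from-yes (Fin.all? λ i → Fin.all? λ j →
  j ≟ i ⊎-dec j ≟ i ⁺ ⊎-dec j ≟ i ⁺ ⁺ ⊎-dec j ≟ i ⁺ ⁺ ⁺ ⊎-dec i ≟ j ⁺ ⁺ ⊎-dec i ≟ j ⁺)

_⁺^_ : Fin 6 → ℕ → Fin 6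
i ⁺^ zero  = i
i ⁺^ suc k = i ⁺ ⁺^ k

rotation : ∀ i j → ∃ λ (k : Fin 6) → j ≡ i ⁺^ toℕ k
rotation = from-yes (Fin.all? λ i → Fin.all? λ j → Fin.any? λ (k : Fin 6) → j ≟ i ⁺^ toℕ k)

rotate : {P : Fin 6 → Set} → (∀ i → P i → P (i ⁺)) → ∀ {i} → P i → ∀ j → P j
rotate {P} step {i} p j with rotation i j
... | k , refl = iterate (toℕ k) p
  where
  iterate : ∀ {i} k → P i → P (i ⁺^ k)
  iterate zero    p = p
  iterate (suc k) p = iterate k (step _ p)

bySymmetry : {R : Fin 6 → Fin 6 → Set} → (∀ {i j} → R i j → R j i) →
  (∀ i → R i i) → (∀ i → R i (i ⁺)) → (∀ i → R i (i ⁺ ⁺)) → (∀ i → R i (i ⁺ ⁺ ⁺)) →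
  ∀ i j → R i j
bySymmetry sym r₀ r₁ r₂ r₃ i j with offsetWithin3 i j
... | inj₁ refl                               = r₀ i
... | inj₂ (inj₁ refl)                        = r₁ i
... | inj₂ (inj₂ (inj₁ refl))                 = r₂ i
... | inj₂ (inj₂ (inj₂ (inj₁ refl)))          = r₃ i
... | inj₂ (inj₂ (inj₂ (inj₂ (inj₁ refl))))   = sym (r₂ j)
... | inj₂ (inj₂ (inj₂ (inj₂ (inj₂ refl))))   = sym (r₁ j)

sameEdge? : {A : Set} → DecidableEquality A → (p q : A × A) → Dec (SameEdge p q)
sameEdge? _≟ᴬ_ (u , v) (u′ , v′) = (u ≟ᴬ u′ ×-dec v ≟ᴬ v′) ⊎-dec (u ≟ᴬ v′ ×-dec v ≟ᴬ u′)

sameEdge-injective : {A B : Set} {f : A → B} → (∀ {x y} → f x ≡ f y → x ≡ y) →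
  ∀ {p q} → SameEdge (Data.Product.map f f p) (Data.Product.map f f q) → SameEdge p q
sameEdge-injective f-inj (inj₁ (u≡u′ , v≡v′)) = inj₁ (f-inj u≡u′ , f-inj v≡v′)
sameEdge-injective f-inj (inj₂ (u≡v′ , v≡u′)) = inj₂ (f-inj u≡v′ , f-inj v≡u′)

WheelVertex : Set
WheelVertex = Fin 6 ⊎ Fin 6

wheelPlusEdge : Fin 6 → Fin 6 → Fin 13 → WheelVertex × WheelVertex
wheelPlusEdge i j k with Data.Fin.splitAt 6 k
... | inj₁ m = inj₁ m , inj₁ (m ⁺)
... | inj₂ k′ with Data.Fin.splitAt 6 k′
...   | inj₁ m = inj₁ m , inj₂ m
...   | inj₂ _ = inj₂ i , inj₂ j

wheelPlusEdge-distinct : ∀ i j k l → SameEdge (wheelPlusEdge i j k) (wheelPlusEdge i j l) → k ≡ l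
wheelPlusEdge-distinct = from-yes (Fin.all? λ i → Fin.all? λ j → Fin.all? λ k → Fin.all? λ l →
  sameEdge? (Data.Sum.Properties.≡-dec _≟_ _≟_) (wheelPlusEdge i j k) (wheelPlusEdge i j l) →-dec k ≟ l)

data PappusVertex : Set where
  cycle spoke outer : Fin 6 → PappusVertex

pappus : CubicModel
pappus = record
  { order = 18
  ; edges = pappusEdges
  ; Label = PappusVertex
  ; label = lookup (cycle 0F ∷ cycle 1F ∷ cycle 2F ∷ cycle 3F ∷ cycle 4F ∷ cycle 5F ∷
                    spoke 5F ∷ outer 0F ∷ spoke 1F ∷ outer 2F ∷ spoke 3F ∷ outer 4F ∷
                    outer 1F ∷ spoke 2F ∷ outer 3F ∷ spoke 4F ∷ outer 5F ∷ spoke 0F ∷ [])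
  ; index = index
  ; label∘index = label∘index
  ; nbr₁ = λ { (cycle i) → cycle (i ⁻) ; (spoke i) → cycle i     ; (outer i) → spoke (i ⁻) }
  ; nbr₂ = λ { (cycle i) → cycle (i ⁺) ; (spoke i) → outer (i ⁻) ; (outer i) → spoke (i ⁺) }
  ; nbr₃ = λ { (cycle i) → spoke i     ; (spoke i) → outer (i ⁺) ; (outer i) → outer (i ⁺ ⁺ ⁺) }
  }
  where
  index : PappusVertex → Fin 18
  index (cycle i) = lookup (# 0 ∷ # 1 ∷ # 2 ∷ # 3 ∷ # 4 ∷ # 5 ∷ []) i
  index (spoke i) = lookup (# 17 ∷ # 8 ∷ # 13 ∷ # 10 ∷ # 15 ∷ # 6 ∷ []) i
  index (outer i) = lookup (# 7 ∷ # 12 ∷ # 9 ∷ # 14 ∷ # 11 ∷ # 16 ∷ []) i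

  label∘index : ∀ l → _ ≡ l
  label∘index (cycle 0F) = refl
  label∘index (cycle 1F) = refl
  label∘index (cycle 2F) = refl
  label∘index (cycle 3F) = refl
  label∘index (cycle 4F) = refl
  label∘index (cycle 5F) = refl
  label∘index (spoke 0F) = refl
  label∘index (spoke 1F) = refl
  label∘index (spoke 2F) = refl
  label∘index (spoke 3F) = refl
  label∘index (spoke 4F) = refl
  label∘index (spoke 5F) = refl
  label∘index (outer 0F) = refl
  label∘index (outer 1F) = refl
  label∘index (outer 2F) = refl
  label∘index (outer 3F) = refl
  label∘index (outer 4F) = refl
  label∘index (outer 5F) = refl

pappus-valid : CubicModel.Valid pappus
pappus-valid = from-yes (CubicModel.valid? pappus)

data DesarguesVertex : Set where
  cycle spoke outer : Fin 6 → DesarguesVertex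
  hub               : Fin 2 → DesarguesVertex

parity : Fin 6 → Fin 2
parity 0F = 0F
parity 1F = 1F
parity 2F = 0F
parity 3F = 1F
parity 4F = 0F
parity 5F = 1F

hubIndex : Fin 2 → Fin 6
hubIndex p = p ↑ˡ 4

desargues : CubicModel
desargues = record
  { order = 20
  ; edges = desarguesEdges
  ; Label = DesarguesVertex
  ; label = lookup (cycle 0F ∷ cycle 1F ∷ cycle 2F ∷ cycle 3F ∷ cycle 4F ∷ cycle 5F ∷
                    spoke 5F ∷ outer 5F ∷ outer 4F ∷ spoke 4F ∷ hub 1F ∷ spoke 2F ∷
                    outer 2F ∷ outer 3F ∷ spoke 3F ∷ hub 0F ∷ spoke 1F ∷ outer 1F ∷ outer 0F ∷ spoke 0F ∷ [])
  ; index = index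
  ; label∘index = label∘index
  ; nbr₁ = λ { (cycle i) → cycle (i ⁻) ; (spoke i) → cycle i              ; (outer i) → spoke i
             ; (hub p) → spoke (hubIndex p ⁻) }
  ; nbr₂ = λ { (cycle i) → cycle (i ⁺) ; (spoke i) → hub (parity (i ⁺)) ; (outer i) → outer (i ⁻)
             ; (hub p) → spoke (hubIndex p ⁺) }
  ; nbr₃ = λ { (cycle i) → spoke i     ; (spoke i) → outer i              ; (outer i) → outer (i ⁺)
             ; (hub p) → spoke (hubIndex p ⁺ ⁺ ⁺) }
  }
  where
  index : DesarguesVertex → Fin 20
  index (cycle i) = lookup (# 0 ∷ # 1 ∷ # 2 ∷ # 3 ∷ # 4 ∷ # 5 ∷ []) i
  index (spoke i) = lookup (# 19 ∷ # 16 ∷ # 11 ∷ # 14 ∷ # 9 ∷ # 6 ∷ []) i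
  index (outer i) = lookup (# 18 ∷ # 17 ∷ # 12 ∷ # 13 ∷ # 8 ∷ # 7 ∷ []) i
  index (hub p)   = lookup (# 15 ∷ # 10 ∷ []) p

  label∘index : ∀ l → _ ≡ l
  label∘index (cycle 0F) = refl
  label∘index (cycle 1F) = refl
  label∘index (cycle 2F) = refl
  label∘index (cycle 3F) = refl
  label∘index (cycle 4F) = refl
  label∘index (cycle 5F) = refl
  label∘index (spoke 0F) = refl
  label∘index (spoke 1F) = refl
  label∘index (spoke 2F) = refl
  label∘index (spoke 3F) = refl
  label∘index (spoke 4F) = refl
  label∘index (spoke 5F) = refl
  label∘index (outer 0F) = refl
  label∘index (outer 1F) = refl
  label∘index (outer 2F) = refl
  label∘index (outer 3F) = refl
  label∘index (outer 4F) = refl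
  label∘index (outer 5F) = refl
  label∘index (hub 0F)   = refl
  label∘index (hub 1F)   = refl

desargues-valid : CubicModel.Valid desargues
desargues-valid = from-yes (CubicModel.valid? desargues)

module Configuration {Γ : Graph} (simple : Simple Γ) (cubic : Cubic Γ) (girth : Girth6 Γ)
  (C : Fin 6 → V Γ) (C-cycle : IsCycle Γ C) (consistent : Consistent Γ C)
  (arcs : ArcsOn6Cycles Γ) (twelve : InducedHasExactlyEdges Γ (InΔ Γ C) 12) where

  open CubicGirth6 simple cubic girth

  C-injective : ∀ {i j} → C i ≡ C j → i ≡ j
  C-injective = proj₁ C-cycle

  C~C⁺ : ∀ i → C i ~ C (i ⁺)
  C~C⁺ = proj₂ C-cycle

  C~C⁻ : ∀ i → C i ~ C (i ⁻)
  C~C⁻ i = ~-sym (subst (λ j → C (i ⁻) ~ C j) (⁻⁺ i) (C~C⁺ (i ⁻)))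

  opaque
    d-spec : ∀ i → ∃ (Neighbourhood (C i) (C (i ⁻)) (C (i ⁺)))
    d-spec i = thirdNeighbour (C~C⁻ i) (C~C⁺ i) (⁻≢⁺ i ∘ C-injective)

  d : Fin 6 → V Γ
  d i = proj₁ (d-spec i)

  C-neighbourhood : ∀ i → Neighbourhood (C i) (C (i ⁻)) (C (i ⁺)) (d i)
  C-neighbourhood i = proj₂ (d-spec i)

  C~d : ∀ i → C i ~ d i
  C~d i = Neighbourhood.~z (C-neighbourhood i)

  C-chordless : ∀ i j → C i ~ C j → j ≡ i ⁺ ⊎ i ≡ j ⁺
  C-chordless = bySymmetry (λ chordless ji → Data.Sum.swap (chordless (~-sym ji)))
    (λ i ii → ⊥-elim (~-irrefl ii refl))
    (λ i _ → inj₁ refl)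
    (λ i c → ⊥-elim (noTriangle (C~C⁺ i) (C~C⁺ (i ⁺)) (~-sym c)))
    (λ i c → ⊥-elim (noQuadrangle (C~C⁺ i) (C~C⁺ (i ⁺)) (C~C⁺ (i ⁺ ⁺)) (~-sym c)
                                  (≢⁺⁺ i ∘ C-injective) (≢⁺⁺ (i ⁺) ∘ C-injective)))

  d≢C : ∀ i j → d i ≢ C j
  d≢C i j di≡Cj with C-chordless i j (subst (C i ~_) di≡Cj (C~d i))
  ... | inj₁ refl = Neighbourhood.y≢z (C-neighbourhood i) (sym di≡Cj)
  ... | inj₂ refl = Neighbourhood.x≢z (C-neighbourhood i) (trans (cong C (⁺⁻ j)) (sym di≡Cj))

  d-injective : ∀ {i j} → d i ≡ d j → i ≡ j
  d-injective {i} {j} = bySymmetry {λ i j → d i ≡ d j → i ≡ j} (λ inj → sym ∘ inj ∘ sym)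
    (λ _ _ → refl)
    (λ i e → ⊥-elim (noTriangle (C~C⁺ i) (C~d′ e) (~-sym (C~d i))))
    (λ i e → ⊥-elim (noQuadrangle (C~C⁺ i) (C~C⁺ (i ⁺)) (C~d′ e) (~-sym (C~d i))
                                  (≢⁺⁺ i ∘ C-injective) (≢-sym (d≢C i (i ⁺)))))
    (λ i e → ⊥-elim (noPentagon (C~C⁺ i) (C~C⁺ (i ⁺)) (C~C⁺ (i ⁺ ⁺)) (C~d′ e) (~-sym (C~d i))
                                (≢⁺⁺ i ∘ C-injective) (≢⁺⁺⁺ i ∘ C-injective) (≢⁺⁺ (i ⁺) ∘ C-injective)
                                (≢-sym (d≢C i (i ⁺))) (≢-sym (d≢C i (i ⁺ ⁺)))))
    i j
    where
    C~d′ : ∀ {i j} → d i ≡ d j → C j ~ d i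
    C~d′ e = subst (C _ ~_) (sym e) (C~d _)

  wheel : WheelVertex → V Γ
  wheel = [ C , d ]

  wheel-injective : ∀ {x y} → wheel x ≡ wheel y → x ≡ y
  wheel-injective {inj₁ i} {inj₁ j} e = cong inj₁ (C-injective e)
  wheel-injective {inj₁ i} {inj₂ j} e = ⊥-elim (d≢C j i (sym e))
  wheel-injective {inj₂ i} {inj₁ j} e = ⊥-elim (d≢C i j e)
  wheel-injective {inj₂ i} {inj₂ j} e = cong inj₂ (d-injective e)

  wheel∈Δ : ∀ x → InΔ Γ C (wheel x)
  wheel∈Δ (inj₁ i) = i , inj₁ refl
  wheel∈Δ (inj₂ i) = i , inj₂ (C~d i)

  d≁d : ∀ i j → ¬ d i ~ d j
  d≁d i j di~dj = noMoreEdges twelve (Data.Product.map wheel wheel ∘ wheelPlusEdge i j) edge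
    (λ k l same → wheelPlusEdge-distinct i j k l (sameEdge-injective wheel-injective same))
    where
    edge : ∀ k → let (x , y) = wheelPlusEdge i j k in
      InΔ Γ C (wheel x) × InΔ Γ C (wheel y) × wheel x ~ wheel y
    edge k with Data.Fin.splitAt 6 k
    ... | inj₁ m = wheel∈Δ (inj₁ m) , wheel∈Δ (inj₁ (m ⁺)) , C~C⁺ m
    ... | inj₂ k′ with Data.Fin.splitAt 6 k′
    ...   | inj₁ m = wheel∈Δ (inj₁ m) , wheel∈Δ (inj₂ m) , C~d m
    ...   | inj₂ _ = wheel∈Δ (inj₂ i) , wheel∈Δ (inj₂ j) , di~dj

  C~d⇒≡ : ∀ {j k} → C j ~ d k → j ≡ k
  C~d⇒≡ {j} {k} Cj~dk with Neighbourhood.exhaustive (C-neighbourhood j) Cj~dk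
  ... | inj₁ dk≡C        = ⊥-elim (d≢C k _ dk≡C)
  ... | inj₂ (inj₁ dk≡C) = ⊥-elim (d≢C k _ dk≡C)
  ... | inj₂ (inj₂ dk≡dj) = sym (d-injective dk≡dj)

  opaque
    e-spec : ∀ i → ∃ λ x → d (i ⁻) ~ x × d (i ⁺) ~ x
    e-spec i = common (closeHexagon arcs (~-sym (C~C⁻ i)) (C~C⁺ i) (C~d (i ⁺))
                                     (⁻≢⁺ i ∘ C-injective) (≢-sym (d≢C (i ⁺) i)))
      where
      common : HexagonClosure (C (i ⁻)) (C i) (C (i ⁺)) (d (i ⁺)) → ∃ λ x → d (i ⁻) ~ x × d (i ⁺) ~ x
      common record { x₄ = x ; x₅ = y ; x₃~x₄ = d~x ; x₄~x₅ = x~y ; x₅~x₀ = y~C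
                    ; x₄≢x₀ = x≢C ; x₅≢x₁ = y≢C }
        with Neighbourhood.exhaustive (C-neighbourhood (i ⁻)) (~-sym y~C)
      ... | inj₂ (inj₁ refl) = ⊥-elim (y≢C (cong C (⁻⁺ i)))
      ... | inj₂ (inj₂ refl) = x , ~-sym x~y , d~x
      ... | inj₁ refl with Neighbourhood.exhaustive (C-neighbourhood (i ⁻ ⁻)) (~-sym x~y)
      ...   | inj₁ refl        = ⊥-elim (⁻⁻⁻≢⁺ i (C~d⇒≡ (~-sym d~x)))
      ...   | inj₂ (inj₁ refl) = ⊥-elim (x≢C (cong C (⁻⁺ (i ⁻))))
      ...   | inj₂ (inj₂ refl) = ⊥-elim (d≁d (i ⁺) (i ⁻ ⁻) d~x)

  e : Fin 6 → V Γ
  e i = proj₁ (e-spec i)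

  d⁻~e : ∀ i → d (i ⁻) ~ e i
  d⁻~e i = proj₁ (proj₂ (e-spec i))

  d⁺~e : ∀ i → d (i ⁺) ~ e i
  d⁺~e i = proj₂ (proj₂ (e-spec i))

  d~e⁻ : ∀ i → d i ~ e (i ⁻)
  d~e⁻ i = subst (λ j → d j ~ e (i ⁻)) (⁻⁺ i) (d⁺~e (i ⁻))

  d~e⁺ : ∀ i → d i ~ e (i ⁺)
  d~e⁺ i = subst (λ j → d j ~ e (i ⁺)) (⁺⁻ i) (d⁻~e (i ⁺))

  e-unique : ∀ {i x} → d (i ⁻) ~ x → d (i ⁺) ~ x → x ≡ e i
  e-unique {i} d⁻~x d⁺~x with neighbour-≟ d⁻~x (d⁻~e i)
  ... | yes x≡e = x≡e
  ... | no x≢e  = ⊥-elim (atMostOneCommonNeighbour d⁻~x (~-sym d⁺~x) (d⁻~e i) (~-sym (d⁺~e i))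
                                             (⁻≢⁺ i ∘ d-injective) x≢e)

  e≢C : ∀ i j → e i ≢ C j
  e≢C i j ei≡Cj = ⁻≢⁺ i (trans (sym (C~d⇒≡ (C~ (d⁻~e i)))) (C~d⇒≡ (C~ (d⁺~e i))))
    where
    C~ : ∀ {k} → d k ~ e i → C j ~ d k
    C~ dk~e = subst (_~ _) ei≡Cj (~-sym dk~e)

  e≢d : ∀ i j → e i ≢ d j
  e≢d i j ei≡dj = d≁d (i ⁻) j (subst (d (i ⁻) ~_) ei≡dj (d⁻~e i))

  γ : Aut Γ
  γ = proj₁ consistent

  γ-C : ∀ i → to γ (C i) ≡ C (i ⁺)
  γ-C = proj₂ consistent

  γ-adj : ∀ {u v} → u ~ v → to γ u ~ to γ v
  γ-adj = adj→ γ _ _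

  γ-injective : ∀ {u v} → to γ u ≡ to γ v → u ≡ v
  γ-injective {u} {v} γu≡γv = trans (sym (from-to γ u)) (trans (cong (from γ) γu≡γv) (from-to γ v))

  γ-C⁻ : ∀ i → to γ (C (i ⁻)) ≡ C (i ⁺ ⁻)
  γ-C⁻ i = trans (γ-C (i ⁻)) (cong C (trans (⁻⁺ i) (sym (⁺⁻ i))))

  opaque
    γ-d : ∀ i → to γ (d i) ≡ d (i ⁺)
    γ-d i with Neighbourhood.exhaustive (C-neighbourhood (i ⁺)) (subst (_~ to γ (d i)) (γ-C i) (γ-adj (C~d i)))
    ... | inj₁ γd≡C        = ⊥-elim (d≢C i (i ⁻) (γ-injective (trans γd≡C (sym (γ-C⁻ i)))))
    ... | inj₂ (inj₁ γd≡C) = ⊥-elim (d≢C i (i ⁺) (γ-injective (trans γd≡C (sym (γ-C (i ⁺))))))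
    ... | inj₂ (inj₂ γd≡d) = γd≡d

  γ-d⁻ : ∀ i → to γ (d (i ⁻)) ≡ d (i ⁺ ⁻)
  γ-d⁻ i = trans (γ-d (i ⁻)) (cong d (trans (⁻⁺ i) (sym (⁺⁻ i))))

  opaque
    γ-e : ∀ i → to γ (e i) ≡ e (i ⁺)
    γ-e i = e-unique (subst (_~ to γ (e i)) (γ-d⁻ i) (γ-adj (d⁻~e i)))
                     (subst (_~ to γ (e i)) (γ-d (i ⁺)) (γ-adj (d⁺~e i)))

  -- Γ has no decidable equality, but e₀ and e₂ are both neighbours of d₁.
  e₀≟e₂ : Dec (e 0F ≡ e 2F)
  e₀≟e₂ = neighbour-≟ (d⁺~e 0F) (d⁻~e 2F)

  e-rotate : ∀ i → e (i ⁻) ≡ e (i ⁺) → e (i ⁺ ⁻) ≡ e (i ⁺ ⁺)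
  e-rotate i e⁻≡e⁺ = trans (cong e (trans (⁺⁻ i) (sym (⁻⁺ i))))
                          (trans (sym (γ-e (i ⁻))) (trans (cong (to γ) e⁻≡e⁺) (γ-e (i ⁺))))

  module PappusCase (e⁻≢e⁺ : ∀ i → e (i ⁻) ≢ e (i ⁺)) where

    d-neighbourhood : ∀ i → Neighbourhood (d i) (C i) (e (i ⁻)) (e (i ⁺))
    d-neighbourhood i = neighbourhood (~-sym (C~d i)) (d~e⁻ i) (d~e⁺ i)
                                      (≢-sym (e≢C _ i)) (≢-sym (e≢C _ i)) (e⁻≢e⁺ i)

    e≁e⁺ : ∀ j → ¬ e j ~ e (j ⁺)
    e≁e⁺ j ej~ej⁺ =
      [ e≢d _ _ , [ e≢d _ _ , (λ e⁺⁺≡e → e⁻≢e⁺ (j ⁺) (trans (cong e (⁺⁻ j)) (sym e⁺⁺≡e))) ] ]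
        (Neighbourhood.exhaustive e⁺-neighbourhood (subst₂ _~_ (γ-e j) (γ-e (j ⁺)) (γ-adj ej~ej⁺)))
      where
      e⁺-neighbourhood : Neighbourhood (e (j ⁺)) (d (j ⁺ ⁻)) (d (j ⁺ ⁺)) (e j)
      e⁺-neighbourhood = neighbourhood (~-sym (d⁻~e (j ⁺))) (~-sym (d⁺~e (j ⁺))) (~-sym ej~ej⁺)
        (⁻≢⁺ (j ⁺) ∘ d-injective) (λ d≡e → e≢d j _ (sym d≡e)) (λ d≡e → e≢d j _ (sym d≡e))

    e₂~e₅ : e 2F ~ e 5F
    e₂~e₅ = closing (closeHexagon arcs (~-sym (C~d 0F)) (C~C⁺ 0F) (C~d 1F)
                                  (d≢C 0F 1F) (≢-sym (d≢C 1F 0F)))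
      where
      closing : HexagonClosure (d 0F) (C 0F) (C 1F) (d 1F) → e 2F ~ e 5F
      closing record { x₄ = x ; x₅ = y ; x₃~x₄ = d~x ; x₄~x₅ = x~y ; x₅~x₀ = y~d
                     ; x₄≢x₂ = x≢C ; x₅≢x₁ = y≢C }
        with Neighbourhood.exhaustive (d-neighbourhood 1F) d~x
           | Neighbourhood.exhaustive (d-neighbourhood 0F) (~-sym y~d)
      ... | inj₁ refl        | _                = ⊥-elim (x≢C refl)
      ... | inj₂ _           | inj₁ refl        = ⊥-elim (y≢C refl)
      ... | inj₂ (inj₁ refl) | inj₂ (inj₁ refl) = ⊥-elim (e≁e⁺ 5F (~-sym x~y))
      ... | inj₂ (inj₁ refl) | inj₂ (inj₂ refl) = ⊥-elim (e≁e⁺ 0F x~y)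
      ... | inj₂ (inj₂ refl) | inj₂ (inj₁ refl) = x~y
      ... | inj₂ (inj₂ refl) | inj₂ (inj₂ refl) = ⊥-elim (e≁e⁺ 1F (~-sym x~y))

    e~e⁺⁺⁺ : ∀ i → e i ~ e (i ⁺ ⁺ ⁺)
    e~e⁺⁺⁺ = rotate {λ i → e i ~ e (i ⁺ ⁺ ⁺)}
      (λ i ei~e⁺⁺⁺ → subst₂ _~_ (γ-e i) (γ-e (i ⁺ ⁺ ⁺)) (γ-adj ei~e⁺⁺⁺)) e₂~e₅

    pappus-cover : LocallyBijective pappus λ { (cycle i) → C i ; (spoke i) → d i ; (outer i) → e i }
    pappus-cover (cycle i) = C-neighbourhood i
    pappus-cover (spoke i) = d-neighbourhood i
    pappus-cover (outer i) = neighbourhood (~-sym (d⁻~e i)) (~-sym (d⁺~e i)) (e~e⁺⁺⁺ i)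
      (⁻≢⁺ i ∘ d-injective) (λ d≡e → e≢d _ _ (sym d≡e)) (λ d≡e → e≢d _ _ (sym d≡e))

  module DesarguesCase (e⁻≡e⁺ : ∀ i → e (i ⁻) ≡ e (i ⁺)) where

    opaque
      f-spec : ∀ i → ∃ (Neighbourhood (d i) (C i) (e (i ⁺)))
      f-spec i = thirdNeighbour (~-sym (C~d i)) (d~e⁺ i) (≢-sym (e≢C _ i))

    f : Fin 6 → V Γ
    f i = proj₁ (f-spec i)

    d-neighbourhood : ∀ i → Neighbourhood (d i) (C i) (e (i ⁺)) (f i)
    d-neighbourhood i = proj₂ (f-spec i)

    d~f : ∀ i → d i ~ f i
    d~f i = Neighbourhood.~z (d-neighbourhood i)

    f≢d : ∀ i j → f i ≢ d j
    f≢d i j fi≡dj = d≁d i j (subst (d i ~_) fi≡dj (d~f i))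

    e-neighbourhood : ∀ j → Neighbourhood (e j) (d (j ⁻)) (d (j ⁺)) (d (j ⁺ ⁺ ⁺))
    e-neighbourhood j = neighbourhood (~-sym (d⁻~e j)) (~-sym (d⁺~e j)) e~d⁺⁺⁺
      (⁻≢⁺ j ∘ d-injective) (⁻≢⁺⁺⁺ j ∘ d-injective) (≢⁺⁺ (j ⁺) ∘ d-injective)
      where
      e~d⁺⁺⁺ : e j ~ d (j ⁺ ⁺ ⁺)
      e~d⁺⁺⁺ = subst (_~ d (j ⁺ ⁺ ⁺)) (trans (sym (e⁻≡e⁺ (j ⁺))) (cong e (⁺⁻ j)))
                     (~-sym (d⁺~e (j ⁺ ⁺)))

    e~⇒≡d : ∀ {j x} → e j ~ x → ∃ λ k → x ≡ d k
    e~⇒≡d {j} ej~x = [ (_ ,_) , [ (_ ,_) , (_ ,_) ] ] (Neighbourhood.exhaustive (e-neighbourhood j) ej~x)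

    e-parity : ∀ j → e (hubIndex (parity j)) ≡ e j
    e-parity 0F = refl
    e-parity 1F = refl
    e-parity 2F = e⁻≡e⁺ 1F
    e-parity 3F = e⁻≡e⁺ 2F
    e-parity 4F = trans (e⁻≡e⁺ 1F) (e⁻≡e⁺ 3F)
    e-parity 5F = trans (e⁻≡e⁺ 2F) (e⁻≡e⁺ 4F)

    opaque
      γ-f : ∀ i → to γ (f i) ≡ f (i ⁺)
      γ-f i with Neighbourhood.exhaustive (d-neighbourhood (i ⁺))
                   (subst (_~ to γ (f i)) (γ-d i) (γ-adj (d~f i)))
      ... | inj₁ γf≡C        = ⊥-elim (Neighbourhood.x≢z (d-neighbourhood i)
                                         (sym (γ-injective (trans γf≡C (sym (γ-C i))))))
      ... | inj₂ (inj₁ γf≡e) = ⊥-elim (Neighbourhood.y≢z (d-neighbourhood i)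
                                         (sym (γ-injective (trans γf≡e (sym (γ-e (i ⁺)))))))
      ... | inj₂ (inj₂ γf≡f) = γf≡f

    f₀~f₁ : f 0F ~ f 1F
    f₀~f₁ = closing (closeHexagon arcs (~-sym (C~d 0F)) (C~C⁺ 0F) (C~d 1F)
                                  (d≢C 0F 1F) (≢-sym (d≢C 1F 0F)))
      where
      closing : HexagonClosure (d 0F) (C 0F) (C 1F) (d 1F) → f 0F ~ f 1F
      closing record { x₄ = x ; x₅ = y ; x₃~x₄ = d~x ; x₄~x₅ = x~y ; x₅~x₀ = y~d
                     ; x₄≢x₂ = x≢C ; x₅≢x₁ = y≢C }
        with Neighbourhood.exhaustive (d-neighbourhood 1F) d~x
           | Neighbourhood.exhaustive (d-neighbourhood 0F) (~-sym y~d)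
      ... | inj₁ refl        | _                = ⊥-elim (x≢C refl)
      ... | inj₂ _           | inj₁ refl        = ⊥-elim (y≢C refl)
      ... | inj₂ (inj₁ refl) | inj₂ (inj₁ refl) = ⊥-elim (e≢d _ _ (proj₂ (e~⇒≡d x~y)))
      ... | inj₂ (inj₁ refl) | inj₂ (inj₂ refl) = ⊥-elim (f≢d _ _ (proj₂ (e~⇒≡d x~y)))
      ... | inj₂ (inj₂ refl) | inj₂ (inj₁ refl) = ⊥-elim (f≢d _ _ (proj₂ (e~⇒≡d (~-sym x~y))))
      ... | inj₂ (inj₂ refl) | inj₂ (inj₂ refl) = ~-sym x~y

    f~f⁺ : ∀ i → f i ~ f (i ⁺)
    f~f⁺ = rotate {λ i → f i ~ f (i ⁺)}
      (λ i fi~f⁺ → subst₂ _~_ (γ-f i) (γ-f (i ⁺)) (γ-adj fi~f⁺)) f₀~f₁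

    f~f⁻ : ∀ i → f i ~ f (i ⁻)
    f~f⁻ i = ~-sym (subst (λ j → f (i ⁻) ~ f j) (⁻⁺ i) (f~f⁺ (i ⁻)))

    f⁻≢f⁺ : ∀ i → f (i ⁻) ≢ f (i ⁺)
    f⁻≢f⁺ i f⁻≡f⁺ = Neighbourhood.y≢z (d-neighbourhood (i ⁻))
      (trans (cong e (⁻⁺ i)) (sym (e-unique (d~f (i ⁻)) (subst (d (i ⁺) ~_) (sym f⁻≡f⁺) (d~f (i ⁺))))))

    desargues-cover : LocallyBijective desargues
      λ { (cycle i) → C i ; (spoke i) → d i ; (outer i) → f i ; (hub p) → e (hubIndex p) }
    desargues-cover (cycle i) = C-neighbourhood i
    desargues-cover (spoke i) =
      subst (λ x → Neighbourhood (d i) (C i) x (f i)) (sym (e-parity (i ⁺))) (d-neighbourhood i)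
    desargues-cover (outer i) = neighbourhood (~-sym (d~f i)) (f~f⁻ i) (f~f⁺ i)
      (λ d≡f → f≢d _ _ (sym d≡f)) (λ d≡f → f≢d _ _ (sym d≡f)) (f⁻≢f⁺ i)
    desargues-cover (hub p)   = e-neighbourhood (hubIndex p)

  e-periodic : e 0F ≡ e 2F → ∀ i → e (i ⁻) ≡ e (i ⁺)
  e-periodic = rotate {λ i → e (i ⁻) ≡ e (i ⁺)} e-rotate

  e-aperiodic : e 0F ≢ e 2F → ∀ i → e (i ⁻) ≢ e (i ⁺)
  e-aperiodic e₀≢e₂ i e⁻≡e⁺ = e₀≢e₂ (rotate {λ i → e (i ⁻) ≡ e (i ⁺)} e-rotate e⁻≡e⁺ 1F)

mainTheorem5 : (Γ : Graph) → Simple Γ → Connected Γ → Cubic Γ → Girth6 Γ →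
    (C : Fin 6 → V Γ) → IsCycle Γ C → Consistent Γ C →
    ArcsOn6Cycles Γ →
    InducedHasExactlyEdges Γ (InΔ Γ C) 12 →
    Iso Γ Pappus ⊎ Iso Γ Desargues
mainTheorem5 Γ simple connected cubic girth C C-cycle consistent arcs twelve = classify e₀≟e₂
  where
  open CubicGirth6 simple cubic girth
  open Configuration simple cubic girth C C-cycle consistent arcs twelve

  classify : Dec (e 0F ≡ e 2F) → Iso Γ Pappus ⊎ Iso Γ Desargues
  classify (no e₀≢e₂)  = inj₁ (Covering.iso connected pappus pappus-valid _
                                 (PappusCase.pappus-cover (e-aperiodic e₀≢e₂)) 0F)
  classify (yes e₀≡e₂) = inj₂ (Covering.iso connected desargues desargues-valid _
                                 (DesarguesCase.desargues-cover (e-periodic e₀≡e₂)) 0F)
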